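{- Let $K_{m,n}$ be a complete bipartite graph with $m,n\geq 2$. Then for any edge $e$, the eigenvalues of the eccentricity matrix $\varepsilon(K_{m,n}-e)$ are $-2$ with multiplicity $m+n-4$, together with the roots of the polynomial $$p(x) = x^4-2(m+n-4)x^3 + [4mn-12(m+n) + 15]x^2 + [16mn - 6(m+n) -40]x - 4[5mn-14(m+n)+32].$$
   Context: All graphs are finite, simple and connected. For a connected graph $G$, $d_G(u,v)$ is the length of a shortest $u$–$v$ path, and the eccentricity of a vertex $u$ is $e(u)=\max\{d_G(u,v): v\in V(G)\}$. The eccentricity matrix $\varepsilon(G)$ is the $|V(G)|\times|V(G)|$ matrix indexed by $V(G)$ with $\varepsilon(G)_{uv}=d_G(u,v)$ if $d_G(u,v)=\min\{e(u),e(v)\}$ and $\varepsilon(G)_{uv}=0$ otherwise. $G-e$ denotes the graph obtained from $G$ by deleting the edge $e$ (keeping all vertices). -}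

module Defs where

open import Data.Bool using (Bool; true; false; _∧_; _∨_; not; if_then_else_; _xor_)
open import Data.Nat as ℕ using (ℕ; zero; suc; _≡ᵇ_; _<ᵇ_)
open import Data.Fin using (Fin; zero; suc; toℕ; punchIn; inject+; raise)
open import Data.Integer as ℤ using (ℤ; +_; _+_; _-_; _*_; _^_)

Graph : ℕ → Set
Graph N = Fin N → Fin N → Bool

_==_ : ∀ {N} → Fin N → Fin N → Bool
u == v = toℕ u ≡ᵇ toℕ v

anyFin : ∀ {N} → (Fin N → Bool) → Bool
anyFin {zero}  f = false
anyFin {suc N} f = f zero ∨ anyFin (λ i → f (suc i))

reach : ∀ {N} → Graph N → ℕ → Fin N → Fin N → Bool
reach G zero    u v = u == v
reach G (suc k) u v = reach G k u v ∨ anyFin (λ w → G u w ∧ reach G k w v)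

-- least k ∈ {s, s+1, …} with reach G k u v, searching `fuel` steps
-- (returns the last searched value if none found; irrelevant for connected G)
search : ∀ {N} → Graph N → Fin N → Fin N → ℕ → ℕ → ℕ
search G u v s zero       = s
search G u v s (suc fuel) = if reach G s u v then s else search G u v (suc s) fuel

-- shortest-path distance d_G(u,v) (a shortest path has length < N)
dist : ∀ {N} → Graph N → Fin N → Fin N → ℕ
dist {N} G u v = search G u v 0 N

maxFin : ∀ {N} → (Fin N → ℕ) → ℕ
maxFin {zero}  f = 0
maxFin {suc N} f = f zero ℕ.⊔ maxFin (λ i → f (suc i))

ecc : ∀ {N} → Graph N → Fin N → ℕ
ecc G u = maxFin (dist G u)

eccMatrix : ∀ {N} → Graph N → Fin N → Fin N → ℤ
eccMatrix G u v =
  if dist G u v ≡ᵇ (ecc G u ℕ.⊓ ecc G v) then + dist G u v else + 0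

altSum : ∀ {n} → (Fin n → ℤ) → ℤ
altSum {zero}  f = + 0
altSum {suc n} f = f zero - altSum (λ i → f (suc i))

det : ∀ n → (Fin n → Fin n → ℤ) → ℤ
det zero    A = + 1
det (suc n) A = altSum (λ j → A zero j * det n (λ r c → A (suc r) (punchIn j c)))

charPoly : ∀ {n} → (Fin n → Fin n → ℤ) → ℤ → ℤ
charPoly {n} A x = det n (λ i j → (if i == j then x else + 0) - A i j)

K : ∀ m n → Graph (m ℕ.+ n)
K m n u v = (toℕ u <ᵇ m) xor (toℕ v <ᵇ m)

deleteEdge : ∀ {N} → Graph N → Fin N → Fin N → Graph N
deleteEdge G a b u v = G u v ∧ not ((u == a ∧ v == b) ∨ (u == b ∧ v == a))

p : ℕ → ℕ → ℤ → ℤ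
p m n x =
  x ^ 4 - + 2 * (M + N - + 4) * x ^ 3
  + (+ 4 * M * N - + 12 * (M + N) + + 15) * x ^ 2
  + (+ 16 * M * N - + 6 * (M + N) - + 40) * x
  - + 4 * (+ 5 * M * N - + 14 * (M + N) + + 32)
  where
  M = + m
  N = + n

module Submission where

-- Write X, Y for the parts of K_{m,n} (|X| = m, |Y| = n) and ab, a ∈ X, b ∈ Y, for the deleted edge.
-- In G = K_{m,n} − ab every vertex has one of four types, X∖{a}, Y∖{b}, a or b, and distances and
-- eccentricities only depend on the types: d(a,b) = 3, e(a) = e(b) = 3 and all other eccentricities
-- are 2. So ε(G) is a matrix w(type u, type v) with zero diagonal, and its characteristic polynomial
-- χ is invariant under reordering the vertices. Two vertices of the same type s give the recurrence
-- χ(s s L) = 2y χ(s L) − y² χ(L) with y = x + w(s,s) = x + 2 (subtract one row from the other and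
-- expand), whose solution is χ(sᵏ⁺¹ L) = yᵏ ((k+1) χ(s L) − k y χ(L)). Peeling off the m − 1
-- vertices of X∖{a} and then the n − 1 vertices of Y∖{b} leaves four determinants of size at most 4.

open import Defs
open import Data.Bool using (Bool; true; false; if_then_else_; _∧_; _∨_; not; _xor_)
open import Data.Bool.Properties using (T-≡; ∨-conicalˡ; ∨-zeroʳ; ∨-identityʳ; ∨-comm; ∧-identityʳ; ∧-zeroʳ; if-eta; xor-same)
open import Data.Empty using (⊥-elim)
open import Data.Fin using (Fin; zero; suc; toℕ; punchIn; punchOut; fromℕ<)
open import Data.Fin.Properties using (toℕ-injective; toℕ<n; toℕ-fromℕ<; punchIn-injective; punchInᵢ≢i; punchIn-punchOut)
open import Data.Integer using (ℤ; +_)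
open import Data.Nat as ℕ using (ℕ; zero; suc)
import Data.Nat.Properties as ℕ
open import Data.Product using (Σ; _×_; _,_; proj₁; proj₂)
open import Data.Sum using (inj₁; inj₂)
open import Data.Vec using (Vec; []; _∷_; lookup; tabulate; replicate; _++_; _∷ʳ_; cast)
open import Data.Vec.Properties using (cast-is-id; lookup∘tabulate; tabulate∘lookup; tabulate-cong; lookup-replicate)
open import Function using (_∘_; Equivalence)
open import Relation.Binary.Construct.Closure.ReflexiveTransitive using (Star; ε; _◅_; _◅◅_; gmap)
open import Relation.Binary.PropositionalEquality
open import Relation.Nullary using (¬_; contradiction; yes; no)

adjSwap : ∀ {n} → Fin (suc n) → Fin (suc (suc n)) → Fin (suc (suc n))
adjSwap         zero    zero          = suc zero
adjSwap         zero    (suc zero)    = zero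
adjSwap         zero    (suc (suc i)) = suc (suc i)
adjSwap {suc n} (suc k) zero          = zero
adjSwap {suc n} (suc k) (suc i)       = suc (adjSwap k i)

adjSwap-involutive : ∀ {n} (k : Fin (suc n)) i → adjSwap k (adjSwap k i) ≡ i
adjSwap-involutive         zero    zero          = refl
adjSwap-involutive         zero    (suc zero)    = refl
adjSwap-involutive         zero    (suc (suc i)) = refl
adjSwap-involutive {suc n} (suc k) zero          = refl
adjSwap-involutive {suc n} (suc k) (suc i)       = cong suc (adjSwap-involutive k i)

adjSwap-injective : ∀ {n} (k : Fin (suc n)) {i j} → adjSwap k i ≡ adjSwap k j → i ≡ j
adjSwap-injective k {i} {j} eq =
  trans (sym (adjSwap-involutive k i)) (trans (cong (adjSwap k) eq) (adjSwap-involutive k j))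

module Determinant where

  open import Data.Integer using (-[1+_]; _+_; _-_; _*_; -_)
  import Data.Integer.Properties as ℤ
  open import Data.Integer.Tactic.RingSolver using (solve-∀)

  Matrix : ℕ → Set
  Matrix n = Fin n → Fin n → ℤ

  minor : ∀ {n} → Matrix (suc n) → Fin (suc n) → Fin (suc n) → Matrix n
  minor A i j r c = A (punchIn i r) (punchIn j c)

  transpose : ∀ {n} → Matrix n → Matrix n
  transpose A i j = A j i

  withRow₀ : ∀ {n} → Matrix (suc n) → (Fin (suc n) → ℤ) → Matrix (suc n)
  withRow₀ A r zero    = r
  withRow₀ A r (suc i) = A (suc i)

  i≡-i⇒i≡0 : ∀ {i} → i ≡ - i → i ≡ + 0
  i≡-i⇒i≡0 {+ zero}    _  = refl
  i≡-i⇒i≡0 {+ suc _}   ()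
  i≡-i⇒i≡0 { -[1+ _ ]} ()

  altSum-cong : ∀ {n} {f g : Fin n → ℤ} → (∀ i → f i ≡ g i) → altSum f ≡ altSum g
  altSum-cong {zero}  f≗g = refl
  altSum-cong {suc n} f≗g = cong₂ _-_ (f≗g zero) (altSum-cong (f≗g ∘ suc))

  altSum-zero : ∀ {n} {f : Fin n → ℤ} → (∀ i → f i ≡ + 0) → altSum f ≡ + 0
  altSum-zero {zero}  f≗0 = refl
  altSum-zero {suc n} f≗0 = cong₂ _-_ (f≗0 zero) (altSum-zero (f≗0 ∘ suc))

  altSum-+ : ∀ {n} (f g : Fin n → ℤ) → altSum (λ i → f i + g i) ≡ altSum f + altSum g
  altSum-+ {zero}  f g = refl
  altSum-+ {suc n} f g = trans (cong (_-_ (f zero + g zero)) (altSum-+ (f ∘ suc) (g ∘ suc)))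
    (interchange (f zero) (g zero) (altSum (f ∘ suc)) (altSum (g ∘ suc)))
    where
    interchange : ∀ a b c d → a + b - (c + d) ≡ a - c + (b - d)
    interchange = solve-∀

  altSum-neg : ∀ {n} (f : Fin n → ℤ) → altSum (λ i → - f i) ≡ - altSum f
  altSum-neg {zero}  f = refl
  altSum-neg {suc n} f = trans (cong (_-_ (- f zero)) (altSum-neg (f ∘ suc)))
    (neg-distrib-- (f zero) (altSum (f ∘ suc)))
    where
    neg-distrib-- : ∀ a b → - a - - b ≡ - (a - b)
    neg-distrib-- = solve-∀

  altSum-- : ∀ {n} (f g : Fin n → ℤ) → altSum (λ i → f i - g i) ≡ altSum f - altSum g
  altSum-- f g = trans (altSum-+ f (λ i → - g i)) (cong (_+_ (altSum f)) (altSum-neg g))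

  altSum-*ˡ : ∀ {n} (c : ℤ) (f : Fin n → ℤ) → altSum (λ i → c * f i) ≡ c * altSum f
  altSum-*ˡ {zero}  c f = sym (ℤ.*-zeroʳ c)
  altSum-*ˡ {suc n} c f = trans (cong (_-_ (c * f zero)) (altSum-*ˡ c (f ∘ suc)))
    (factor c (f zero) (altSum (f ∘ suc)))
    where
    factor : ∀ c a b → c * a - c * b ≡ c * (a - b)
    factor = solve-∀

  altSum-comm : ∀ {m n} (f : Fin m → Fin n → ℤ) →
    altSum (λ i → altSum (f i)) ≡ altSum (λ j → altSum (λ i → f i j))
  altSum-comm {zero}  {n} f = sym (altSum-zero {n} (λ _ → refl))
  altSum-comm {suc m} f = trans (cong (_-_ (altSum (f zero))) (altSum-comm (f ∘ suc)))
    (sym (altSum-- (f zero) (λ j → altSum (λ i → f (suc i) j))))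

  det-cong : ∀ n (A B : Matrix n) → (∀ i j → A i j ≡ B i j) → det n A ≡ det n B
  det-cong zero    A B A≗B = refl
  det-cong (suc n) A B A≗B = altSum-cong (λ j → cong₂ _*_ (A≗B zero j)
    (det-cong n (minor A zero j) (minor B zero j) (λ r c → A≗B (suc r) (punchIn j c))))

  det-expandCol₀ : ∀ n (A : Matrix (suc n)) →
    det (suc n) A ≡ altSum (λ i → A i zero * det n (minor A i zero))
  det-expandCol₀ zero    A = refl
  det-expandCol₀ (suc n) A = cong (_-_ (A zero zero * det (suc n) (minor A zero zero))) (begin
      altSum (λ j → A zero (suc j) * det (suc n) (minor A zero (suc j)))
    ≡⟨ altSum-cong (λ j → cong (A zero (suc j) *_) (det-expandCol₀ n (minor A zero (suc j)))) ⟩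
      altSum (λ j → A zero (suc j) * altSum (λ i → A (suc i) zero * d i j))
    ≡⟨ altSum-cong (λ j → sym (altSum-*ˡ (A zero (suc j)) (λ i → A (suc i) zero * d i j))) ⟩
      altSum (λ j → altSum (λ i → A zero (suc j) * (A (suc i) zero * d i j)))
    ≡⟨ altSum-comm (λ j i → A zero (suc j) * (A (suc i) zero * d i j)) ⟩
      altSum (λ i → altSum (λ j → A zero (suc j) * (A (suc i) zero * d i j)))
    ≡⟨ altSum-cong (λ i → trans (altSum-cong (λ j → swap-factors (A zero (suc j)) (A (suc i) zero) (d i j)))
                                 (altSum-*ˡ (A (suc i) zero) (λ j → A zero (suc j) * d i j))) ⟩
      altSum (λ i → A (suc i) zero * altSum (λ j → A zero (suc j) * d i j))
    ∎)
    where
    open ≡-Reasoning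
    d : Fin (suc n) → Fin (suc n) → ℤ
    d i j = det n (λ r c → A (suc (punchIn i r)) (suc (punchIn j c)))
    swap-factors : ∀ a b c → a * (b * c) ≡ b * (a * c)
    swap-factors = solve-∀

  det-transpose : ∀ n (A : Matrix n) → det n (transpose A) ≡ det n A
  det-transpose zero    A = refl
  det-transpose (suc n) A =
    trans (altSum-cong (λ j → cong (A j zero *_) (det-transpose n (minor A j zero)))) (sym (det-expandCol₀ n A))

  expansionTail : ∀ {n} → Matrix (suc (suc n)) → ℤ
  expansionTail {n} A = altSum (λ j → A zero (suc (suc j)) * det (suc n) (minor A zero (suc (suc j))))

  det-swapCols₀ : ∀ n (A : Matrix (suc (suc n))) →
    det (suc (suc n)) (λ i j → A i (adjSwap zero j)) ≡ - det (suc (suc n)) A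
  expansionTail-swapCols₀ : ∀ n (A : Matrix (suc (suc n))) →
    expansionTail (λ i j → A i (adjSwap zero j)) ≡ - expansionTail A

  det-swapCols₀ n A = begin
      A zero (suc zero) * det (suc n) (minor A′ zero zero)
        - (A zero zero * det (suc n) (minor A′ zero (suc zero)) - expansionTail A′)
    ≡⟨ cong₂ (λ d₁ d₀ → A zero (suc zero) * d₁ - (A zero zero * d₀ - expansionTail A′))
         (det-cong (suc n) (minor A′ zero zero) (minor A zero (suc zero)) (λ r → λ { zero → refl ; (suc c) → refl }))
         (det-cong (suc n) (minor A′ zero (suc zero)) (minor A zero zero) (λ r → λ { zero → refl ; (suc c) → refl })) ⟩
      A zero (suc zero) * d₁ - (A zero zero * d₀ - expansionTail A′)
    ≡⟨ cong (λ t → A zero (suc zero) * d₁ - (A zero zero * d₀ - t)) (expansionTail-swapCols₀ n A) ⟩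
      A zero (suc zero) * d₁ - (A zero zero * d₀ - - expansionTail A)
    ≡⟨ rearrange (A zero (suc zero)) (A zero zero) d₁ d₀ (expansionTail A) ⟩
      - det (suc (suc n)) A
    ∎
    where
    open ≡-Reasoning
    A′ : Matrix (suc (suc n))
    A′ i j = A i (adjSwap zero j)
    d₀ = det (suc n) (minor A zero zero)
    d₁ = det (suc n) (minor A zero (suc zero))
    rearrange : ∀ a b d₁ d₀ t → a * d₁ - (b * d₀ - - t) ≡ - (b * d₀ - (a * d₁ - t))
    rearrange = solve-∀

  expansionTail-swapCols₀ zero    A = refl
  expansionTail-swapCols₀ (suc n) A = trans
    (altSum-cong (λ j → trans
      (cong (A zero (suc (suc j)) *_) (trans
        (det-cong (suc (suc n)) (minor (λ i j → A i (adjSwap zero j)) zero (suc (suc j)))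
          (λ r c → minor A zero (suc (suc j)) r (adjSwap zero c))
          (λ r → λ { zero → refl ; (suc zero) → refl ; (suc (suc c)) → refl }))
        (det-swapCols₀ n (minor A zero (suc (suc j))))))
      (sym (ℤ.neg-distribʳ-* (A zero (suc (suc j))) (det (suc (suc n)) (minor A zero (suc (suc j))))))))
    (altSum-neg (λ j → A zero (suc (suc j)) * det (suc (suc n)) (minor A zero (suc (suc j)))))

  det-swapRows : ∀ n (k : Fin (suc n)) (A : Matrix (suc (suc n))) →
    det (suc (suc n)) (λ i j → A (adjSwap k i) j) ≡ - det (suc (suc n)) A
  det-swapRows n zero A = begin
      det (suc (suc n)) (λ i j → A (adjSwap zero i) j)
    ≡⟨ det-transpose (suc (suc n)) (λ i j → A (adjSwap zero i) j) ⟨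
      det (suc (suc n)) (λ i j → transpose A i (adjSwap zero j))
    ≡⟨ det-swapCols₀ n (transpose A) ⟩
      - det (suc (suc n)) (transpose A)
    ≡⟨ cong -_ (det-transpose (suc (suc n)) A) ⟩
      - det (suc (suc n)) A
    ∎
    where open ≡-Reasoning
  det-swapRows (suc n) (suc k) A = trans
    (altSum-cong (λ j → trans (cong (A zero j *_) (det-swapRows n k (minor A zero j)))
                              (sym (ℤ.neg-distribʳ-* (A zero j) (det (suc (suc n)) (minor A zero j))))))
    (altSum-neg (λ j → A zero j * det (suc (suc n)) (minor A zero j)))

  det-swapCols : ∀ n (k : Fin (suc n)) (A : Matrix (suc (suc n))) →
    det (suc (suc n)) (λ i j → A i (adjSwap k j)) ≡ - det (suc (suc n)) A
  det-swapCols n k A = trans (sym (det-transpose (suc (suc n)) (λ i j → A i (adjSwap k j))))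
    (trans (det-swapRows n k (transpose A)) (cong -_ (det-transpose (suc (suc n)) A)))

  det-swapBoth : ∀ n (k : Fin (suc n)) (A : Matrix (suc (suc n))) →
    det (suc (suc n)) (λ i j → A (adjSwap k i) (adjSwap k j)) ≡ det (suc (suc n)) A
  det-swapBoth n k A = trans (det-swapCols n k (λ i j → A (adjSwap k i) j))
    (trans (cong -_ (det-swapRows n k A)) (ℤ.neg-involutive (det (suc (suc n)) A)))

  det-linearRow₀ : ∀ n (A : Matrix (suc n)) (r s : Fin (suc n) → ℤ) →
    det (suc n) (withRow₀ A (λ j → r j + s j)) ≡ det (suc n) (withRow₀ A r) + det (suc n) (withRow₀ A s)
  det-linearRow₀ n A r s =
    trans (altSum-cong (λ j → ℤ.*-distribʳ-+ (det n (minor A zero j)) (r j) (s j)))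
          (altSum-+ (λ j → r j * det n (minor A zero j)) (λ j → s j * det n (minor A zero j)))

  det-equalRows₀₁ : ∀ n (A : Matrix (suc (suc n))) → (∀ j → A zero j ≡ A (suc zero) j) →
    det (suc (suc n)) A ≡ + 0
  det-equalRows₀₁ n A row₀≡row₁ = i≡-i⇒i≡0 (trans
    (det-cong (suc (suc n)) A (λ i j → A (adjSwap zero i) j) (λ
      { zero j → row₀≡row₁ j ; (suc zero) j → sym (row₀≡row₁ j) ; (suc (suc i)) j → refl }))
    (det-swapRows n zero A))

  det-subtractRow₁ : ∀ n (A : Matrix (suc (suc n))) →
    det (suc (suc n)) A ≡ det (suc (suc n)) (withRow₀ A (λ j → A zero j - A (suc zero) j))
  det-subtractRow₁ n A = begin
      det (suc (suc n)) A
    ≡⟨ det-cong (suc (suc n)) A (withRow₀ A (λ j → (A zero j - A (suc zero) j) + A (suc zero) j))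
         (λ { zero j → split (A zero j) (A (suc zero) j) ; (suc i) j → refl }) ⟩
      det (suc (suc n)) (withRow₀ A (λ j → (A zero j - A (suc zero) j) + A (suc zero) j))
    ≡⟨ det-linearRow₀ (suc n) A (λ j → A zero j - A (suc zero) j) (A (suc zero)) ⟩
      det (suc (suc n)) A′ + det (suc (suc n)) (withRow₀ A (A (suc zero)))
    ≡⟨ cong (_+_ (det (suc (suc n)) A′)) (det-equalRows₀₁ n (withRow₀ A (A (suc zero))) (λ j → refl)) ⟩
      det (suc (suc n)) A′ + + 0
    ≡⟨ ℤ.+-identityʳ (det (suc (suc n)) A′) ⟩
      det (suc (suc n)) A′
    ∎
    where
    open ≡-Reasoning
    A′ = withRow₀ A (λ j → A zero j - A (suc zero) j)
    split : ∀ a b → a ≡ (a - b) + b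
    split = solve-∀

  det-entry₀₀ : ∀ n (A B : Matrix (suc n)) →
    (∀ j → A zero (suc j) ≡ B zero (suc j)) → (∀ i j → A (suc i) j ≡ B (suc i) j) →
    det (suc n) A ≡ det (suc n) B + (A zero zero - B zero zero) * det n (minor A zero zero)
  det-entry₀₀ n A B row₀ rows = begin
      A zero zero * d - tail A
    ≡⟨ cong (_-_ (A zero zero * d)) (altSum-cong (λ j → cong₂ _*_ (row₀ j)
         (det-cong n (minor A zero (suc j)) (minor B zero (suc j)) (λ r c → rows r (punchIn (suc j) c))))) ⟩
      A zero zero * d - tail B
    ≡⟨ rearrange (A zero zero) (B zero zero) d (tail B) ⟩
      (B zero zero * d - tail B) + (A zero zero - B zero zero) * d
    ≡⟨ cong (λ d′ → (B zero zero * d′ - tail B) + (A zero zero - B zero zero) * d)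
            (det-cong n (minor A zero zero) (minor B zero zero) (λ r c → rows r (suc c))) ⟩
      det (suc n) B + (A zero zero - B zero zero) * d
    ∎
    where
    open ≡-Reasoning
    d = det n (minor A zero zero)
    tail : Matrix (suc n) → ℤ
    tail M = altSum (λ j → M zero (suc j) * det n (minor M zero (suc j)))
    rearrange : ∀ a b d t → a * d - t ≡ (b * d - t) + (a - b) * d
    rearrange = solve-∀

open Determinant

==-refl : ∀ {n} (i : Fin n) → (i == i) ≡ true
==-refl i = Equivalence.to T-≡ (ℕ.≡⇒≡ᵇ (toℕ i) (toℕ i) refl)

==⇒≡ : ∀ {n} {i j : Fin n} → (i == j) ≡ true → i ≡ j
==⇒≡ {i = i} {j} i==j = toℕ-injective (ℕ.≡ᵇ⇒≡ (toℕ i) (toℕ j) (Equivalence.from T-≡ i==j))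

≢⇒== : ∀ {n} {i j : Fin n} → ¬ i ≡ j → (i == j) ≡ false
≢⇒== {i = i} {j} i≢j with i == j in i==j
... | true  = contradiction (==⇒≡ i==j) i≢j
... | false = refl

==-false⇒≢ : ∀ {n} {i j : Fin n} → (i == j) ≡ false → ¬ i ≡ j
==-false⇒≢ {i = i} i==j refl with trans (sym i==j) (==-refl i)
... | ()

==-injective : ∀ {m n} (σ : Fin m → Fin n) → (∀ {i j} → σ i ≡ σ j → i ≡ j) →
  ∀ i j → (σ i == σ j) ≡ (i == j)
==-injective σ σ-injective i j with i == j in i==j
... | true  = trans (cong (λ k → σ k == σ j) (==⇒≡ i==j)) (==-refl (σ j))
... | false = ≢⇒== (==-false⇒≢ i==j ∘ σ-injective)

data AdjSwap {A : Set} : ∀ {n} → Vec A n → Vec A n → Set where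
  here  : ∀ {n s t} {v : Vec A n} → AdjSwap (s ∷ t ∷ v) (t ∷ s ∷ v)
  there : ∀ {n s} {v w : Vec A n} → AdjSwap v w → AdjSwap (s ∷ v) (s ∷ w)

_↭_ : ∀ {A : Set} {n} → Vec A n → Vec A n → Set
_↭_ = Star AdjSwap

AdjSwap⇒lookup : ∀ {A : Set} {n} {v w : Vec A (suc (suc n))} → AdjSwap v w →
  Σ (Fin (suc n)) (λ k → ∀ i → lookup w i ≡ lookup v (adjSwap k i))
AdjSwap⇒lookup here = zero , λ { zero → refl ; (suc zero) → refl ; (suc (suc i)) → refl }
AdjSwap⇒lookup {n = zero}  (there (there ()))
AdjSwap⇒lookup {n = suc n} (there sw) with AdjSwap⇒lookup sw
... | k , w≗v∘adjSwap = suc k , λ { zero → refl ; (suc i) → w≗v∘adjSwap i }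

↭-cons : ∀ {A : Set} {n} (s : A) {v w : Vec A n} → v ↭ w → (s ∷ v) ↭ (s ∷ w)
↭-cons s = gmap (s ∷_) there

∷-↭-∷ʳ : ∀ {A : Set} {n} (s : A) (v : Vec A n) → (s ∷ v) ↭ (v ∷ʳ s)
∷-↭-∷ʳ s []      = ε
∷-↭-∷ʳ s (t ∷ v) = here ◅ ↭-cons t (∷-↭-∷ʳ s v)

tabulate-↭ : ∀ {A : Set} {n} (f : Fin (suc n) → A) (i : Fin (suc n)) → tabulate f ↭ (f i ∷ tabulate (f ∘ punchIn i))
tabulate-↭             f zero    = ε
tabulate-↭ {n = suc n} f (suc i) = ↭-cons (f zero) (tabulate-↭ (f ∘ suc) i) ◅◅ (here ◅ ε)

module TypedCharPoly {T : Set} (w : T → T → ℤ) where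

  open import Data.Integer using (_+_; _-_; _*_)
  import Data.Integer.Properties as ℤ
  open import Data.Integer.Tactic.RingSolver using (solve-∀)

  weightMatrix : ∀ {n} → Vec T n → Matrix n
  weightMatrix v i j = if i == j then + 0 else w (lookup v i) (lookup v j)

  charMatrix : ∀ {n} → Vec T n → ℤ → Matrix n
  charMatrix v x i j = (if i == j then x else + 0) - weightMatrix v i j

  -- Opaque, because conversion checking would otherwise unfold the Laplace expansion of χ,
  -- which takes exponential time.
  opaque
    χ : ∀ {n} → Vec T n → ℤ → ℤ
    χ v = charPoly (weightMatrix v)

    χ-def : ∀ {n} (v : Vec T n) x → χ v x ≡ det n (charMatrix v x)
    χ-def v x = refl

  χ-adjSwap : ∀ {n} {v v′ : Vec T n} → AdjSwap v v′ → ∀ x → χ v x ≡ χ v′ x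
  χ-adjSwap {suc zero} (there ()) x
  χ-adjSwap {suc (suc n)} {v} {v′} sw x with AdjSwap⇒lookup sw
  ... | k , v′≗v∘adjSwap = begin
      χ v x
    ≡⟨ χ-def v x ⟩
      det (suc (suc n)) M
    ≡⟨ det-swapBoth n k M ⟨
      det (suc (suc n)) (λ i j → M (adjSwap k i) (adjSwap k j))
    ≡⟨ det-cong _ _ _ conjugate ⟩
      det (suc (suc n)) (charMatrix v′ x)
    ≡⟨ χ-def v′ x ⟨
      χ v′ x
    ∎
    where
    open ≡-Reasoning
    M : Matrix (suc (suc n))
    M = charMatrix v x
    conjugate : ∀ i j → M (adjSwap k i) (adjSwap k j) ≡ charMatrix v′ x i j
    conjugate i j rewrite ==-injective (adjSwap k) (adjSwap-injective k) i j
                        | v′≗v∘adjSwap i | v′≗v∘adjSwap j = refl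

  χ-↭ : ∀ {n} {v v′ : Vec T n} → v ↭ v′ → ∀ x → χ v x ≡ χ v′ x
  χ-↭ ε           x = refl
  χ-↭ (sw ◅ v↭v′) x = trans (χ-adjSwap sw x) (χ-↭ v↭v′ x)

  χ-cast : ∀ {n n′} (eq : n ≡ n′) (v : Vec T n) x → χ (cast eq v) x ≡ χ v x
  χ-cast refl v x = cong (λ u → χ u x) (cast-is-id refl v)

  -- After subtracting row 1 from row 0, only the first two entries of row 0, ±(x + w s s), survive.
  χ-pair : ∀ {n} (s : T) (v : Vec T n) x → let y = x + w s s in
    χ (s ∷ s ∷ v) x ≡ + 2 * y * χ (s ∷ v) x - y * y * χ v x
  χ-pair {n} s v x = begin
      χ (s ∷ s ∷ v) x
    ≡⟨ χ-def (s ∷ s ∷ v) x ⟩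
      det (suc (suc n)) M
    ≡⟨ det-subtractRow₁ n M ⟩
      r zero * P - (r (suc zero) * det (suc n) (minor M′ zero (suc zero)) - expansionTail M′)
    ≡⟨ cong₂ (λ d t → r zero * P - (r (suc zero) * d - t))
         (det-entry₀₀ n (minor M′ zero (suc zero)) (charMatrix (s ∷ v) x) (λ _ → refl)
           (λ i → λ { zero → refl ; (suc c) → refl }))
         (altSum-zero (λ j → cong (_* det (suc n) (minor M′ zero (suc (suc j))))
                                  (ℤ.+-inverseʳ (M zero (suc (suc j)))))) ⟩
      r zero * P - (r (suc zero) * (P + r (suc zero) * Q) - + 0)
    ≡⟨ simplify x (w s s) P Q ⟩
      + 2 * (x + w s s) * P - (x + w s s) * (x + w s s) * Q
    ≡⟨ cong₂ (λ P Q → + 2 * (x + w s s) * P - (x + w s s) * (x + w s s) * Q) (χ-def (s ∷ v) x) (χ-def v x) ⟨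
      + 2 * (x + w s s) * χ (s ∷ v) x - (x + w s s) * (x + w s s) * χ v x
    ∎
    where
    open ≡-Reasoning
    M : Matrix (suc (suc n))
    M = charMatrix (s ∷ s ∷ v) x
    r : Fin (suc (suc n)) → ℤ
    r j = M zero j - M (suc zero) j
    M′ : Matrix (suc (suc n))
    M′ = withRow₀ M r
    P Q : ℤ
    P = det (suc n) (charMatrix (s ∷ v) x)
    Q = det n (charMatrix v x)
    simplify : ∀ x c P Q → let a = x - + 0 - (+ 0 - c) ; b = + 0 - c - (x - + 0) in
      a * P - (b * (P + b * Q) - + 0) ≡ + 2 * (x + c) * P - (x + c) * (x + c) * Q
    simplify = solve-∀

module Recurrence where

  open import Data.Integer using (_+_; _-_; _*_; _^_)
  open import Data.Integer.Tactic.RingSolver using (solve-∀)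

  recurrence-unique : (step : ℤ → ℤ → ℤ) (f g : ℕ → ℤ) → f 0 ≡ g 0 → f 1 ≡ g 1 →
    (∀ k → f (suc (suc k)) ≡ step (f (suc k)) (f k)) → (∀ k → g (suc (suc k)) ≡ step (g (suc k)) (g k)) →
    ∀ k → f k ≡ g k
  recurrence-unique step f g f₀≡g₀ f₁≡g₁ f-rec g-rec k = proj₁ (agree k)
    where
    agree : ∀ k → f k ≡ g k × f (suc k) ≡ g (suc k)
    agree zero    = f₀≡g₀ , f₁≡g₁
    agree (suc k) with agree k
    ... | fₖ≡gₖ , fₖ₊₁≡gₖ₊₁ =
      fₖ₊₁≡gₖ₊₁ , trans (f-rec k) (trans (cong₂ step fₖ₊₁≡gₖ₊₁ fₖ≡gₖ) (sym (g-rec k)))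

  repeatedRoot-closedForm : ∀ (y : ℤ) (h : ℕ → ℤ) →
    (∀ k → h (suc (suc k)) ≡ + 2 * y * h (suc k) - y * y * h k) →
    ∀ k → h (suc k) ≡ y ^ k * (+ suc k * h 1 - + k * (y * h 0))
  repeatedRoot-closedForm y h h-rec k =
    recurrence-unique step h closed refl (initial (h 1) (y * h 0)) h-rec closed-rec (suc k)
    where
    step : ℤ → ℤ → ℤ
    step a b = + 2 * y * a - y * y * b
    closed : ℕ → ℤ
    closed zero    = h 0
    closed (suc k) = y ^ k * (+ suc k * h 1 - + k * (y * h 0))
    initial : ∀ a b → a ≡ + 1 * (+ 1 * a - + 0 * b)
    initial = solve-∀
    closed-rec₀ : ∀ y a b → y * + 1 * (+ 2 * a - + 1 * (y * b)) ≡ + 2 * y * (+ 1 * (+ 1 * a - + 0 * (y * b))) - y * y * b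
    closed-rec₀ = solve-∀
    closed-rec₊ : ∀ y z K a b →
      y * (y * z) * ((+ 1 + (+ 1 + (+ 1 + K))) * a - (+ 1 + (+ 1 + K)) * (y * b))
        ≡ + 2 * y * (y * z * ((+ 1 + (+ 1 + K)) * a - (+ 1 + K) * (y * b))) - y * y * (z * ((+ 1 + K) * a - K * (y * b)))
    closed-rec₊ = solve-∀
    closed-rec : ∀ k → closed (suc (suc k)) ≡ step (closed (suc k)) (closed k)
    closed-rec zero    = closed-rec₀ y (h 1) (h 0)
    closed-rec (suc k) = closed-rec₊ y (y ^ k) (+ k) (h 1) (h 0)

open Recurrence

anyFin-witness : ∀ {N} (f : Fin N → Bool) w → f w ≡ true → anyFin f ≡ true
anyFin-witness f zero    fw = cong (_∨ anyFin (f ∘ suc)) fw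
anyFin-witness f (suc w) fw = trans (cong (f zero ∨_) (anyFin-witness (f ∘ suc) w fw)) (∨-zeroʳ (f zero))

anyFin-false : ∀ {N} (f : Fin N → Bool) → (∀ w → f w ≡ false) → anyFin f ≡ false
anyFin-false {zero}  f f≗false = refl
anyFin-false {suc N} f f≗false = cong₂ _∨_ (f≗false zero) (anyFin-false (f ∘ suc) (f≗false ∘ suc))

anyFin-select : ∀ {N} (f : Fin N → Bool) v → anyFin (λ w → f w ∧ (w == v)) ≡ f v
anyFin-select f zero = trans (cong₂ _∨_ (∧-identityʳ (f zero)) (anyFin-false _ (λ w → ∧-zeroʳ (f (suc w)))))
                             (∨-identityʳ (f zero))
anyFin-select f (suc v) = trans (cong (_∨ anyFin (λ w → f (suc w) ∧ (w == v))) (∧-zeroʳ (f zero)))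
                                (anyFin-select (f ∘ suc) v)

module Distance {N} (G : Graph N) where

  reach-one : ∀ u v → reach G 1 u v ≡ (u == v) ∨ G u v
  reach-one u v = cong ((u == v) ∨_) (anyFin-select (G u) v)

  reach-step : ∀ k u w v → G u w ≡ true → reach G k w v ≡ true → reach G (suc k) u v ≡ true
  reach-step k u w v uw reach-wv =
    trans (cong (reach G k u v ∨_) (anyFin-witness _ w (cong₂ _∧_ uw reach-wv))) (∨-zeroʳ (reach G k u v))

  reach-antitone : ∀ {d k} u v → k ℕ.≤ d → reach G d u v ≡ false → reach G k u v ≡ false
  reach-antitone {zero}  u v ℕ.z≤n no-reach = no-reach
  reach-antitone {suc d} {k} u v k≤d no-reach with k ℕ.≟ suc d
  ... | yes refl = no-reach
  ... | no  k≢d  = reach-antitone u v (ℕ.≤-pred (ℕ.≤∧≢⇒< k≤d k≢d)) (∨-conicalˡ _ _ no-reach)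

  search-≡ : ∀ {d} u v → reach G d u v ≡ true → (∀ {k} → k ℕ.< d → reach G k u v ≡ false) →
    ∀ s fuel → s ℕ.≤ d → d ℕ.< fuel ℕ.+ s → search G u v s fuel ≡ d
  search-≡ u v reach-d below s zero s≤d d<s = ⊥-elim (ℕ.<⇒≱ d<s s≤d)
  search-≡ {d} u v reach-d below s (suc fuel) s≤d d<fuel+s with ℕ.m≤n⇒m<n∨m≡n s≤d
  ... | inj₂ refl rewrite reach-d = refl
  ... | inj₁ s<d  rewrite below s<d =
    search-≡ u v reach-d below (suc s) fuel s<d (subst (d ℕ.<_) (sym (ℕ.+-suc fuel s)) d<fuel+s)

  dist-≡ : ∀ {d} u v → d ℕ.< N → reach G d u v ≡ true → (∀ {k} → k ℕ.< d → reach G k u v ≡ false) →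
    dist G u v ≡ d
  dist-≡ {d} u v d<N reach-d below =
    search-≡ u v reach-d below 0 N ℕ.z≤n (subst (d ℕ.<_) (sym (ℕ.+-identityʳ N)) d<N)

  dist-zero : ∀ u v → (u == v) ≡ true → dist G u v ≡ 0
  dist-zero u v u==v = dist-≡ u v (ℕ.≤-<-trans ℕ.z≤n (toℕ<n u)) u==v (λ ())

  dist-suc : ∀ {d} u v → suc d ℕ.< N → reach G d u v ≡ false → reach G (suc d) u v ≡ true → dist G u v ≡ suc d
  dist-suc u v d<N no-reach reach-d =
    dist-≡ u v d<N reach-d (λ k<d → reach-antitone u v (ℕ.≤-pred k<d) no-reach)

maxFin-≤ : ∀ {N} (f : Fin N → ℕ) {k} → (∀ v → f v ℕ.≤ k) → maxFin f ℕ.≤ k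
maxFin-≤ {zero}  f bound = ℕ.z≤n
maxFin-≤ {suc N} f bound = ℕ.⊔-lub (bound zero) (maxFin-≤ (f ∘ suc) (bound ∘ suc))

maxFin-≡ : ∀ {N} (f : Fin N → ℕ) {k} w → (∀ v → f v ℕ.≤ k) → f w ≡ k → maxFin f ≡ k
maxFin-≡ f zero    bound refl = ℕ.m≥n⇒m⊔n≡m (maxFin-≤ (f ∘ suc) (bound ∘ suc))
maxFin-≡ f (suc w) bound fw≡k =
  trans (cong (f zero ℕ.⊔_) (maxFin-≡ (f ∘ suc) w (bound ∘ suc) fw≡k)) (ℕ.m≤n⇒m⊔n≡n (bound zero))

<ᵇ-true : ∀ {k n} → k ℕ.< n → (k ℕ.<ᵇ n) ≡ true
<ᵇ-true k<n = Equivalence.to T-≡ (ℕ.<⇒<ᵇ k<n)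

<ᵇ-false : ∀ {k n} → n ℕ.≤ k → (k ℕ.<ᵇ n) ≡ false
<ᵇ-false {k} {n} n≤k with k ℕ.<ᵇ n in k<ᵇn
... | true  = ⊥-elim (ℕ.<⇒≱ (ℕ.<ᵇ⇒< k n (Equivalence.from T-≡ k<ᵇn)) n≤k)
... | false = refl

punchIn-<ᵇ-above : ∀ {n} (i : Fin (suc n)) (j : Fin n) t → t ℕ.≤ toℕ i →
  (toℕ (punchIn i j) ℕ.<ᵇ t) ≡ (toℕ j ℕ.<ᵇ t)
punchIn-<ᵇ-above i       j       zero    _           = refl
punchIn-<ᵇ-above (suc i) zero    (suc t) _           = refl
punchIn-<ᵇ-above (suc i) (suc j) (suc t) (ℕ.s≤s t≤i) = punchIn-<ᵇ-above i j t t≤i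

punchIn-<ᵇ-below : ∀ {n} (i : Fin (suc n)) (j : Fin n) t → toℕ i ℕ.≤ t →
  (toℕ (punchIn i j) ℕ.<ᵇ suc t) ≡ (toℕ j ℕ.<ᵇ t)
punchIn-<ᵇ-below zero    j       t       _           = refl
punchIn-<ᵇ-below (suc i) zero    (suc t) _           = refl
punchIn-<ᵇ-below (suc i) (suc j) (suc t) (ℕ.s≤s i≤t) = punchIn-<ᵇ-below i j t i≤t

tabulate-threshold : ∀ {A : Set} (s t : A) p q {N} (eq : p ℕ.+ q ≡ N) →
  tabulate {n = N} (λ k → if toℕ k ℕ.<ᵇ p then s else t) ≡ cast eq (replicate p s ++ replicate q t)
tabulate-threshold s t zero q refl = trans
  (trans (tabulate-cong (λ k → sym (lookup-replicate k t))) (tabulate∘lookup (replicate q t)))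
  (sym (cast-is-id refl (replicate q t)))
tabulate-threshold s t (suc p) q {suc N} eq = cong (s ∷_) (tabulate-threshold s t p q (ℕ.suc-injective eq))

K-sameSide : ∀ m n (a b : Fin (m ℕ.+ n)) → (toℕ a ℕ.<ᵇ m) ≡ (toℕ b ℕ.<ᵇ m) → K m n a b ≡ false
K-sameSide m n a b same = trans (cong (_xor (toℕ b ℕ.<ᵇ m)) same) (xor-same (toℕ b ℕ.<ᵇ m))

-- inX and inY are the vertices of X∖{a} and Y∖{b}; endX = a and endY = b.
data VertexType : Set where
  inX inY endX endY : VertexType

-- (is a, is b, lies in X): adjacency in K_{m,n} − ab only depends on this triple.
signature : VertexType → Bool × Bool × Bool
signature inX  = false , false , true
signature inY  = false , false , false
signature endX = true  , false , true
signature endY = false , true  , false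

edgeBetween : Bool × Bool × Bool → Bool × Bool × Bool → Bool
edgeBetween (isa , isb , onX) (isa′ , isb′ , onX′) = (onX xor onX′) ∧ not ((isa ∧ isb′) ∨ (isb ∧ isa′))

adjacent : VertexType → VertexType → Bool
adjacent s t = edgeBetween (signature s) (signature t)

isEndX isEndY : VertexType → Bool
isEndX t = proj₁ (signature t)
isEndY t = proj₁ (proj₂ (signature t))

ends : ∀ {k} → Vec VertexType k → Vec VertexType (suc (suc k))
ends v = (v ∷ʳ endY) ∷ʳ endX

canonical : ∀ i j → Vec VertexType (suc (suc (suc i ℕ.+ suc j)))
canonical i j = ends (replicate (suc i) inX ++ replicate (suc j) inY)

-- The distance between two distinct vertices of the given types.
typeDist : VertexType → VertexType → ℕ
typeDist endX endY = 3
typeDist endY endX = 3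
typeDist s    t    = if adjacent s t then 1 else 2

typeEcc : VertexType → ℕ
typeEcc endX = 3
typeEcc endY = 3
typeEcc inX  = 2
typeEcc inY  = 2

typeEntry : VertexType → VertexType → ℤ
typeEntry s t = if typeDist s t ℕ.≡ᵇ (typeEcc s ℕ.⊓ typeEcc t) then + typeDist s t else + 0

endX-endY-no-common-neighbour : ∀ t → (adjacent endX t ∧ (isEndY t ∨ adjacent t endY)) ≡ false
endX-endY-no-common-neighbour inX  = refl
endX-endY-no-common-neighbour inY  = refl
endX-endY-no-common-neighbour endX = refl
endX-endY-no-common-neighbour endY = refl

endY-endX-no-common-neighbour : ∀ t → (adjacent endY t ∧ (isEndX t ∨ adjacent t endX)) ≡ false
endY-endX-no-common-neighbour inX  = refl
endY-endX-no-common-neighbour inY  = refl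
endY-endX-no-common-neighbour endX = refl
endY-endX-no-common-neighbour endY = refl

typeDist-≤-typeEcc : ∀ s t → typeDist s t ℕ.≤ typeEcc s
typeDist-≤-typeEcc inX  inX  = ℕ.≤-refl
typeDist-≤-typeEcc inX  inY  = ℕ.s≤s ℕ.z≤n
typeDist-≤-typeEcc inX  endX = ℕ.≤-refl
typeDist-≤-typeEcc inX  endY = ℕ.s≤s ℕ.z≤n
typeDist-≤-typeEcc inY  inX  = ℕ.s≤s ℕ.z≤n
typeDist-≤-typeEcc inY  inY  = ℕ.≤-refl
typeDist-≤-typeEcc inY  endX = ℕ.s≤s ℕ.z≤n
typeDist-≤-typeEcc inY  endY = ℕ.≤-refl
typeDist-≤-typeEcc endX inX  = ℕ.s≤s (ℕ.s≤s ℕ.z≤n)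
typeDist-≤-typeEcc endX inY  = ℕ.s≤s ℕ.z≤n
typeDist-≤-typeEcc endX endX = ℕ.s≤s (ℕ.s≤s ℕ.z≤n)
typeDist-≤-typeEcc endX endY = ℕ.≤-refl
typeDist-≤-typeEcc endY inX  = ℕ.s≤s ℕ.z≤n
typeDist-≤-typeEcc endY inY  = ℕ.s≤s (ℕ.s≤s ℕ.z≤n)
typeDist-≤-typeEcc endY endX = ℕ.≤-refl
typeDist-≤-typeEcc endY endY = ℕ.s≤s (ℕ.s≤s ℕ.z≤n)

module EdgeDeletedKmn (i j : ℕ) (a b : Fin (suc (suc i) ℕ.+ suc (suc j)))
                       (a<m : toℕ a ℕ.< suc (suc i)) (m≤b : suc (suc i) ℕ.≤ toℕ b) where

  open TypedCharPoly typeEntry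
  open import Data.Integer using (_-_)

  m n : ℕ
  m = suc (suc i)
  n = suc (suc j)

  a≢b : ¬ a ≡ b
  a≢b refl = ℕ.<⇒≱ a<m m≤b

  vertexType : Fin (m ℕ.+ n) → VertexType
  vertexType u = if u == a then endX else if u == b then endY else if toℕ u ℕ.<ᵇ m then inX else inY

  signature-vertexType : ∀ u → signature (vertexType u) ≡ (u == a , u == b , (toℕ u ℕ.<ᵇ m))
  signature-vertexType u with u == a in u==a
  ... | true with ==⇒≡ {i = u} {a} u==a
  ...   | refl = cong₂ _,_ refl (cong₂ _,_ (sym (≢⇒== a≢b)) (sym (<ᵇ-true a<m)))
  signature-vertexType u | false with u == b in u==b
  ... | true with ==⇒≡ {i = u} {b} u==b
  ...   | refl = cong (λ c → false , true , c) (sym (<ᵇ-false m≤b))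
  signature-vertexType u | false | false with toℕ u ℕ.<ᵇ m
  ... | true  = refl
  ... | false = refl

  deleteEdge-adjacent : ∀ u v → deleteEdge (K m n) a b u v ≡ adjacent (vertexType u) (vertexType v)
  deleteEdge-adjacent u v = sym (cong₂ edgeBetween (signature-vertexType u) (signature-vertexType v))

  deleteEdge-adjacent′ : ∀ u v → deleteEdge (K m n) b a u v ≡ adjacent (vertexType u) (vertexType v)
  deleteEdge-adjacent′ u v = trans (cong (λ e → K m n u v ∧ not e) (∨-comm (u == b ∧ v == a) (u == a ∧ v == b)))
                                   (deleteEdge-adjacent u v)

  vertexType-a : vertexType a ≡ endX
  vertexType-a rewrite ==-refl a = refl

  vertexType-b : vertexType b ≡ endY
  vertexType-b rewrite ≢⇒== (a≢b ∘ sym) | ==-refl b = refl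

  ==a : ∀ u → (u == a) ≡ isEndX (vertexType u)
  ==a u = cong proj₁ (sym (signature-vertexType u))

  ==b : ∀ u → (u == b) ≡ isEndY (vertexType u)
  ==b u = cong (proj₁ ∘ proj₂) (sym (signature-vertexType u))

  endX-is-a : ∀ u → vertexType u ≡ endX → u ≡ a
  endX-is-a u u∶endX = ==⇒≡ (trans (==a u) (cong isEndX u∶endX))

  endY-is-b : ∀ u → vertexType u ≡ endY → u ≡ b
  endY-is-b u u∶endY = ==⇒≡ (trans (==b u) (cong isEndY u∶endY))

  a′ : Fin (suc (i ℕ.+ n))
  a′ = punchOut (a≢b ∘ sym)

  -- inner enumerates the vertices other than a and b in increasing order.
  inner : Fin (i ℕ.+ n) → Fin (m ℕ.+ n)
  inner k = punchIn b (punchIn a′ k)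

  punchIn-b-a′ : punchIn b a′ ≡ a
  punchIn-b-a′ = punchIn-punchOut (a≢b ∘ sym)

  inner≢a : ∀ k → ¬ inner k ≡ a
  inner≢a k eq = punchInᵢ≢i a′ k (punchIn-injective b _ _ (trans eq (sym punchIn-b-a′)))

  inner≢b : ∀ k → ¬ inner k ≡ b
  inner≢b k = punchInᵢ≢i b (punchIn a′ k)

  a′<m : toℕ a′ ℕ.< m
  a′<m = ℕ.<ᵇ⇒< (toℕ a′) m (Equivalence.from T-≡ (trans (sym (punchIn-<ᵇ-above b a′ m m≤b))
           (trans (cong (λ v → toℕ v ℕ.<ᵇ m) punchIn-b-a′) (<ᵇ-true a<m))))

  inner-onX : ∀ k → (toℕ (inner k) ℕ.<ᵇ m) ≡ (toℕ k ℕ.<ᵇ suc i)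
  inner-onX k = trans (punchIn-<ᵇ-above b (punchIn a′ k) m m≤b) (punchIn-<ᵇ-below a′ k (suc i) (ℕ.≤-pred a′<m))

  vertexType-inner : ∀ k → vertexType (inner k) ≡ (if toℕ k ℕ.<ᵇ suc i then inX else inY)
  vertexType-inner k rewrite ≢⇒== (inner≢a k) | ≢⇒== (inner≢b k) | inner-onX k = refl

  0<i+n : 0 ℕ.< i ℕ.+ n
  0<i+n = ℕ.<-≤-trans (ℕ.s≤s ℕ.z≤n) (ℕ.m≤n+m n i)

  i+suc[j]<i+n : i ℕ.+ suc j ℕ.< i ℕ.+ n
  i+suc[j]<i+n = ℕ.+-monoʳ-< i (ℕ.n<1+n (suc j))

  kX kY : Fin (i ℕ.+ n)
  kX = fromℕ< 0<i+n
  kY = fromℕ< i+suc[j]<i+n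

  vertexType-kX : vertexType (inner kX) ≡ inX
  vertexType-kX = trans (vertexType-inner kX) (cong (λ k → if k ℕ.<ᵇ suc i then inX else inY) (toℕ-fromℕ< 0<i+n))

  vertexType-kY : vertexType (inner kY) ≡ inY
  vertexType-kY = trans (vertexType-inner kY) (cong (λ c → if c then inX else inY) (trans
    (cong (ℕ._<ᵇ suc i) (toℕ-fromℕ< i+suc[j]<i+n))
    (<ᵇ-false (subst (suc i ℕ.≤_) (sym (ℕ.+-suc i j)) (ℕ.s≤s (ℕ.m≤m+n i j))))))

  χ-vertexTypes : ∀ x → χ (tabulate vertexType) x ≡ χ (canonical i j) x
  χ-vertexTypes x = begin
      χ (tabulate vertexType) x
    ≡⟨ χ-↭ (tabulate-↭ vertexType b ◅◅ ↭-cons (vertexType b) (tabulate-↭ (vertexType ∘ punchIn b) a′)) x ⟩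
      χ (vertexType b ∷ vertexType (punchIn b a′) ∷ tabulate (vertexType ∘ inner)) x
    ≡⟨ cong₂ (λ s t → χ (s ∷ t ∷ tabulate (vertexType ∘ inner)) x)
         vertexType-b (trans (cong vertexType punchIn-b-a′) vertexType-a) ⟩
      χ (endY ∷ endX ∷ tabulate (vertexType ∘ inner)) x
    ≡⟨ cong (λ v → χ (endY ∷ endX ∷ v) x)
         (trans (tabulate-cong vertexType-inner) (tabulate-threshold inX inY (suc i) (suc j) i+n≡)) ⟩
      χ (cast (cong (2 ℕ.+_) i+n≡) (endY ∷ endX ∷ W)) x
    ≡⟨ χ-cast (cong (2 ℕ.+_) i+n≡) (endY ∷ endX ∷ W) x ⟩
      χ (endY ∷ endX ∷ W) x
    ≡⟨ χ-↭ (∷-↭-∷ʳ endY (endX ∷ W) ◅◅ ∷-↭-∷ʳ endX (W ∷ʳ endY)) x ⟩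
      χ (canonical i j) x
    ∎
    where
    open ≡-Reasoning
    W = replicate (suc i) inX ++ replicate (suc j) inY
    i+n≡ : suc i ℕ.+ suc j ≡ i ℕ.+ n
    i+n≡ = sym (ℕ.+-suc i (suc j))

  module Eccentricities (G : Graph (m ℕ.+ n)) (G-adjacent : ∀ u v → G u v ≡ adjacent (vertexType u) (vertexType v)) where
    open Distance G

    x₀ y₀ : Fin (m ℕ.+ n)
    x₀ = inner kX
    y₀ = inner kY

    3<N : 3 ℕ.< m ℕ.+ n
    3<N = ℕ.s≤s (ℕ.s≤s (ℕ.≤-trans (ℕ.s≤s (ℕ.s≤s ℕ.z≤n)) (ℕ.m≤n+m n i)))

    G-adjacent-type : ∀ u v {s t} → vertexType u ≡ s → vertexType v ≡ t → G u v ≡ adjacent s t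
    G-adjacent-type u v u∶s v∶t = trans (G-adjacent u v) (cong₂ adjacent u∶s v∶t)

    edge : ∀ u v {s t} → vertexType u ≡ s → vertexType v ≡ t → adjacent s t ≡ true → G u v ≡ true
    edge u v u∶s v∶t s~t = trans (G-adjacent-type u v u∶s v∶t) s~t

    dist-one : ∀ u v {s t} → vertexType u ≡ s → vertexType v ≡ t → (u == v) ≡ false → adjacent s t ≡ true →
      dist G u v ≡ 1
    dist-one u v u∶s v∶t u≠v s~t = dist-suc u v (ℕ.<-trans (ℕ.s≤s (ℕ.s≤s ℕ.z≤n)) 3<N) u≠v
      (trans (reach-one u v) (cong₂ _∨_ u≠v (edge u v u∶s v∶t s~t)))

    dist-two : ∀ u v w {s t r} → vertexType u ≡ s → vertexType v ≡ t → vertexType w ≡ r → (u == v) ≡ false →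
      adjacent s t ≡ false → adjacent s r ≡ true → adjacent r t ≡ true → dist G u v ≡ 2
    dist-two u v w u∶s v∶t w∶r u≠v s≁t s~r r~t = dist-suc u v (ℕ.<-trans (ℕ.n<1+n 2) 3<N)
      (trans (reach-one u v) (cong₂ _∨_ u≠v (trans (G-adjacent-type u v u∶s v∶t) s≁t)))
      (reach-step 1 u w v (edge u w u∶s w∶r s~r) (reach-step 0 w v v (edge w v w∶r v∶t r~t) (==-refl v)))

    dist-three : ∀ u v → (u == v) ≡ false → G u v ≡ false → (∀ w → (G u w ∧ ((w == v) ∨ G w v)) ≡ false) →
      reach G 3 u v ≡ true → dist G u v ≡ 3
    dist-three u v u≠v u≁v no-middle reach-uv = dist-suc u v 3<N
      (cong₂ _∨_ (trans (reach-one u v) (cong₂ _∨_ u≠v u≁v))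
                 (anyFin-false _ (λ w → trans (cong (G u w ∧_) (reach-one w v)) (no-middle w))))
      reach-uv

    dist-a-b : dist G a b ≡ 3
    dist-a-b = dist-three a b (≢⇒== a≢b) (G-adjacent-type a b vertexType-a vertexType-b)
      (λ w → trans (cong₂ _∧_ (G-adjacent-type a w vertexType-a refl)
                              (cong₂ _∨_ (==b w) (G-adjacent-type w b refl vertexType-b)))
                   (endX-endY-no-common-neighbour (vertexType w)))
      (reach-step 2 a y₀ b (edge a y₀ vertexType-a vertexType-kY refl)
        (reach-step 1 y₀ x₀ b (edge y₀ x₀ vertexType-kY vertexType-kX refl)
          (reach-step 0 x₀ b b (edge x₀ b vertexType-kX vertexType-b refl) (==-refl b))))

    dist-b-a : dist G b a ≡ 3
    dist-b-a = dist-three b a (≢⇒== (a≢b ∘ sym)) (G-adjacent-type b a vertexType-b vertexType-a)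
      (λ w → trans (cong₂ _∧_ (G-adjacent-type b w vertexType-b refl)
                              (cong₂ _∨_ (==a w) (G-adjacent-type w a refl vertexType-a)))
                   (endY-endX-no-common-neighbour (vertexType w)))
      (reach-step 2 b x₀ a (edge b x₀ vertexType-b vertexType-kX refl)
        (reach-step 1 x₀ y₀ a (edge x₀ y₀ vertexType-kX vertexType-kY refl)
          (reach-step 0 y₀ a a (edge y₀ a vertexType-kY vertexType-a refl) (==-refl a))))

    dist-spec : ∀ u v → dist G u v ≡ (if u == v then 0 else typeDist (vertexType u) (vertexType v))
    dist-spec u v = dist-by-cases (u == v) refl
      where
      dist-by-cases : ∀ c → (u == v) ≡ c → dist G u v ≡ (if c then 0 else typeDist (vertexType u) (vertexType v))
      dist-by-cases true u==v = dist-zero u v u==v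
      dist-by-cases false u==v with vertexType u in u∶s | vertexType v in v∶t
      ... | inX  | inY  = dist-one u v u∶s v∶t u==v refl
      ... | inX  | endY = dist-one u v u∶s v∶t u==v refl
      ... | inY  | inX  = dist-one u v u∶s v∶t u==v refl
      ... | inY  | endX = dist-one u v u∶s v∶t u==v refl
      ... | endX | inY  = dist-one u v u∶s v∶t u==v refl
      ... | endY | inX  = dist-one u v u∶s v∶t u==v refl
      ... | inX  | inX  = dist-two u v y₀ u∶s v∶t vertexType-kY u==v refl refl refl
      ... | inX  | endX = dist-two u v y₀ u∶s v∶t vertexType-kY u==v refl refl refl
      ... | endX | inX  = dist-two u v y₀ u∶s v∶t vertexType-kY u==v refl refl refl
      ... | inY  | inY  = dist-two u v x₀ u∶s v∶t vertexType-kX u==v refl refl refl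
      ... | inY  | endY = dist-two u v x₀ u∶s v∶t vertexType-kX u==v refl refl refl
      ... | endY | inY  = dist-two u v x₀ u∶s v∶t vertexType-kX u==v refl refl refl
      ... | endX | endY rewrite endX-is-a u u∶s | endY-is-b v v∶t = dist-a-b
      ... | endY | endX rewrite endY-is-b u u∶s | endX-is-a v v∶t = dist-b-a
      ... | endX | endX = ⊥-elim (==-false⇒≢ u==v (trans (endX-is-a u u∶s) (sym (endX-is-a v v∶t))))
      ... | endY | endY = ⊥-elim (==-false⇒≢ u==v (trans (endY-is-b u u∶s) (sym (endY-is-b v v∶t))))

    dist-≤-typeEcc : ∀ u v → dist G u v ℕ.≤ typeEcc (vertexType u)
    dist-≤-typeEcc u v rewrite dist-spec u v with u == v
    ... | true  = ℕ.z≤n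
    ... | false = typeDist-≤-typeEcc (vertexType u) (vertexType v)

    dist-between : ∀ u v {s t} → vertexType u ≡ s → vertexType v ≡ t → (u == v) ≡ false →
      dist G u v ≡ typeDist s t
    dist-between u v u∶s v∶t u≠v =
      trans (dist-spec u v) (cong₂ (λ c d → if c then 0 else d) u≠v (cong₂ typeDist u∶s v∶t))

    farthest : VertexType → Fin (m ℕ.+ n)
    farthest inX  = a
    farthest inY  = b
    farthest endX = b
    farthest endY = a

    dist-farthest : ∀ u → dist G u (farthest (vertexType u)) ≡ typeEcc (vertexType u)
    dist-farthest u with vertexType u in u∶s
    ... | inX  = dist-between u a u∶s vertexType-a (trans (==a u) (cong isEndX u∶s))
    ... | inY  = dist-between u b u∶s vertexType-b (trans (==b u) (cong isEndY u∶s))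
    ... | endX = dist-between u b u∶s vertexType-b (trans (==b u) (cong isEndY u∶s))
    ... | endY = dist-between u a u∶s vertexType-a (trans (==a u) (cong isEndX u∶s))

    ecc-spec : ∀ u → ecc G u ≡ typeEcc (vertexType u)
    ecc-spec u = maxFin-≡ (dist G u) (farthest (vertexType u)) (dist-≤-typeEcc u) (dist-farthest u)

    eccMatrix-spec : ∀ u v → eccMatrix G u v ≡ weightMatrix (tabulate vertexType) u v
    eccMatrix-spec u v rewrite dist-spec u v | ecc-spec u | ecc-spec v
                             | lookup∘tabulate vertexType u | lookup∘tabulate vertexType v with u == v
    ... | true  = if-eta (0 ℕ.≡ᵇ (typeEcc (vertexType u) ℕ.⊓ typeEcc (vertexType v)))
    ... | false = refl

    charPoly-eccMatrix : ∀ x → charPoly (eccMatrix G) x ≡ χ (canonical i j) x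
    charPoly-eccMatrix x = begin
        charPoly (eccMatrix G) x
      ≡⟨ det-cong (m ℕ.+ n) _ (charMatrix (tabulate vertexType) x)
           (λ u v → cong (_-_ (if u == v then x else + 0)) (eccMatrix-spec u v)) ⟩
        det (m ℕ.+ n) (charMatrix (tabulate vertexType) x)
      ≡⟨ χ-def (tabulate vertexType) x ⟨
        χ (tabulate vertexType) x
      ≡⟨ χ-vertexTypes x ⟩
        χ (canonical i j) x
      ∎
      where open ≡-Reasoning

module Evaluation where

  open TypedCharPoly typeEntry
  open import Data.Integer using (_+_; _-_; _*_; _^_)
  import Data.Integer.Properties as ℤ
  open import Data.Integer.Tactic.RingSolver using (solve-∀)
  open import Data.Integer.Solver using (module +-*-Solver)
  open +-*-Solver using (Polynomial; con; _:+_; _:-_; _:*_; _:=_; solve)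

  -- det transcribed onto the solver's syntax: ⟦ χExpr v X ⟧ computes to the determinant in χ-def,
  -- so that the solver can expand the four base cases.
  altSumExpr : ∀ {n} → (Fin n → Polynomial 1) → Polynomial 1
  altSumExpr {zero}  f = con (+ 0)
  altSumExpr {suc n} f = f zero :- altSumExpr (f ∘ suc)

  detExpr : ∀ n → (Fin n → Fin n → Polynomial 1) → Polynomial 1
  detExpr zero    A = con (+ 1)
  detExpr (suc n) A = altSumExpr (λ j → A zero j :* detExpr n (λ r c → A (suc r) (punchIn j c)))

  χExpr : ∀ {n} → Vec VertexType n → Polynomial 1 → Polynomial 1
  χExpr {n} v X = detExpr n (λ i j → (if i == j then X else con (+ 0)) :- con (weightMatrix v i j))

  χ-ends : ∀ x → χ (ends []) x ≡ x * x - + 9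
  χ-ends x = trans (χ-def (ends []) x) (solve 1 (λ X → χExpr (ends []) X := X :* X :- con (+ 9)) refl x)

  χ-inY-ends : ∀ x → χ (ends (inY ∷ [])) x ≡ x * x * x - + 13 * x
  χ-inY-ends x = trans (χ-def (ends (inY ∷ [])) x)
    (solve 1 (λ X → χExpr (ends (inY ∷ [])) X := X :* X :* X :- con (+ 13) :* X) refl x)

  χ-ends-inX : ∀ x → χ (ends [] ∷ʳ inX) x ≡ x * x * x - + 13 * x
  χ-ends-inX x = trans (χ-def (ends [] ∷ʳ inX) x)
    (solve 1 (λ X → χExpr (ends [] ∷ʳ inX) X := X :* X :* X :- con (+ 13) :* X) refl x)

  χ-inY-ends-inX : ∀ x → χ (ends (inY ∷ []) ∷ʳ inX) x ≡ x * x * x * x - + 17 * (x * x) + + 16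
  χ-inY-ends-inX x = trans (χ-def (ends (inY ∷ []) ∷ʳ inX) x)
    (solve 1 (λ X → χExpr (ends (inY ∷ []) ∷ʳ inX) X := X :* X :* X :* X :- con (+ 17) :* (X :* X) :+ con (+ 16)) refl x)

  module _ (x : ℤ) where

    y : ℤ
    y = x + + 2

    χ-inY-block : ∀ j → χ (ends (replicate (suc j) inY)) x
      ≡ y ^ j * (+ suc j * (x * x * x - + 13 * x) - + j * (y * (x * x - + 9)))
    χ-inY-block j = trans
      (repeatedRoot-closedForm y (λ k → χ (ends (replicate k inY)) x) (λ k → χ-pair inY (ends (replicate k inY)) x) j)
      (cong₂ (λ P Q → y ^ j * (+ suc j * P - + j * (y * Q))) (χ-inY-ends x) (χ-ends x))

    χ-inY-block-inX : ∀ j → χ (ends (replicate (suc j) inY) ∷ʳ inX) x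
      ≡ y ^ j * (+ suc j * (x * x * x * x - + 17 * (x * x) + + 16) - + j * (y * (x * x * x - + 13 * x)))
    χ-inY-block-inX j = trans
      (repeatedRoot-closedForm y (λ k → χ (ends (replicate k inY) ∷ʳ inX) x)
        (λ k → χ-pair inY (ends (replicate k inY) ∷ʳ inX) x) j)
      (cong₂ (λ P Q → y ^ j * (+ suc j * P - + j * (y * Q))) (χ-inY-ends-inX x) (χ-ends-inX x))

    χ-canonical : ∀ i j →
      χ (canonical i j) x ≡ y ^ (suc (suc i) ℕ.+ suc (suc j) ℕ.∸ 4) * p (suc (suc i)) (suc (suc j)) x
    χ-canonical i j = begin
        χ (canonical i j) x
      ≡⟨ repeatedRoot-closedForm y (λ k → χ (ends (replicate k inX ++ Ys)) x)
           (λ k → χ-pair inX (ends (replicate k inX ++ Ys)) x) i ⟩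
        y ^ i * (+ suc i * χ (inX ∷ ends Ys) x - + i * (y * χ (ends Ys) x))
      ≡⟨ cong₂ (λ P Q → y ^ i * (+ suc i * P - + i * (y * Q)))
           (trans (χ-↭ (∷-↭-∷ʳ inX (ends Ys)) x) (χ-inY-block-inX j)) (χ-inY-block j) ⟩
        y ^ i * (+ suc i * (y ^ j * (+ suc j * P₄ - + j * (y * P₃)))
                 - + i * (y * (y ^ j * (+ suc j * P₃ - + j * (y * P₂)))))
      ≡⟨ expand x (+ i) (+ j) (y ^ i) (y ^ j) ⟩
        y ^ i * y ^ j * p (suc (suc i)) (suc (suc j)) x
      ≡⟨ cong (_* p (suc (suc i)) (suc (suc j)) x) (trans (cong (y ^_) exponent) (ℤ.^-distribˡ-+-* y i j)) ⟨
        y ^ (suc (suc i) ℕ.+ suc (suc j) ℕ.∸ 4) * p (suc (suc i)) (suc (suc j)) x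
      ∎
      where
      open ≡-Reasoning
      Ys = replicate (suc j) inY
      P₂ = x * x - + 9
      P₃ = x * x * x - + 13 * x
      P₄ = x * x * x * x - + 17 * (x * x) + + 16
      exponent : suc (suc i) ℕ.+ suc (suc j) ℕ.∸ 4 ≡ i ℕ.+ j
      exponent = cong (ℕ._∸ 2) (trans (ℕ.+-suc i (suc j)) (cong suc (ℕ.+-suc i j)))
      expand : ∀ x I J a b → let y = x + + 2 ; M = + 2 + I ; N = + 2 + J in
        a * ((+ 1 + I) * (b * ((+ 1 + J) * (x * x * x * x - + 17 * (x * x) + + 16) - J * (y * (x * x * x - + 13 * x))))
             - I * (y * (b * ((+ 1 + J) * (x * x * x - + 13 * x) - J * (y * (x * x - + 9))))))
        ≡ a * b * (x * (x * (x * (x * + 1))) - + 2 * (M + N - + 4) * (x * (x * (x * + 1)))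
                   + (+ 4 * M * N - + 12 * (M + N) + + 15) * (x * (x * + 1))
                   + (+ 16 * M * N - + 6 * (M + N) - + 40) * x
                   - + 4 * (+ 5 * M * N - + 14 * (M + N) + + 32))
      expand = solve-∀

  eccCharPoly-edgeDeleted : ∀ i j (a b : Fin (suc (suc i) ℕ.+ suc (suc j)))
    (a<m : toℕ a ℕ.< suc (suc i)) (m≤b : suc (suc i) ℕ.≤ toℕ b) (G : Graph (suc (suc i) ℕ.+ suc (suc j))) →
    (let open EdgeDeletedKmn i j a b a<m m≤b in ∀ u v → G u v ≡ adjacent (vertexType u) (vertexType v)) →
    ∀ x → charPoly (eccMatrix G) x
      ≡ (x + + 2) ^ (suc (suc i) ℕ.+ suc (suc j) ℕ.∸ 4) * p (suc (suc i)) (suc (suc j)) x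
  eccCharPoly-edgeDeleted i j a b a<m m≤b G G-adjacent x =
    trans (EdgeDeletedKmn.Eccentricities.charPoly-eccMatrix i j a b a<m m≤b G G-adjacent x) (χ-canonical x i j)

open Evaluation using (eccCharPoly-edgeDeleted)

open import Data.Nat using (_≤_; _+_; _∸_)
open import Data.Integer using () renaming (_+_ to _+ℤ_; _*_ to _*ℤ_; _^_ to _^ℤ_)

theorem2p7 : (m n : ℕ) → 2 ≤ m → 2 ≤ n → (a b : Fin (m + n)) → K m n a b ≡ true →
    (x : ℤ) → charPoly (eccMatrix (deleteEdge (K m n) a b)) x
    ≡ ((x +ℤ + 2) ^ℤ (m + n ∸ 4)) *ℤ p m n x
theorem2p7 (suc (suc i)) (suc (suc j)) (ℕ.s≤s (ℕ.s≤s ℕ.z≤n)) (ℕ.s≤s (ℕ.s≤s ℕ.z≤n)) a b ab∈E x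
  with toℕ a ℕ.<? suc (suc i) | toℕ b ℕ.<? suc (suc i)
... | yes a<m | no b≮m = eccCharPoly-edgeDeleted i j a b a<m (ℕ.≮⇒≥ b≮m) _
  (EdgeDeletedKmn.deleteEdge-adjacent i j a b a<m (ℕ.≮⇒≥ b≮m)) x
... | no a≮m | yes b<m = eccCharPoly-edgeDeleted i j b a b<m (ℕ.≮⇒≥ a≮m) _
  (EdgeDeletedKmn.deleteEdge-adjacent′ i j b a b<m (ℕ.≮⇒≥ a≮m)) x
... | yes a<m | yes b<m = contradiction (trans (sym ab∈E) (K-sameSide (suc (suc i)) (suc (suc j)) a b
  (trans (<ᵇ-true a<m) (sym (<ᵇ-true b<m))))) λ ()
... | no a≮m | no b≮m = contradiction (trans (sym ab∈E) (K-sameSide (suc (suc i)) (suc (suc j)) a b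
  (trans (<ᵇ-false (ℕ.≮⇒≥ a≮m)) (sym (<ᵇ-false (ℕ.≮⇒≥ b≮m)))))) λ ()
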